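{- Let $d\ge 2$ be an integer and let $G$ be a graph without isolated vertices. The following are equivalent: (i) $\Theta_{d-1}(G)\le d$; (ii) $G$ arises from the claw $K_{1,d}$ by replacing each of its vertices by a possibly empty clique; (iii) $G$ contains none of $\bar{K}_{d+1}$, $P_4$, $K_1\cup P_3$, $C_4$ as an induced subgraph.
   Context: All graphs are finite and simple. For a positive integer $p$, a $p$-intersection representation of a graph $G$ is a map $S:V(G)\to 2^U$ into the subsets of a ground set $U$ such that distinct vertices $u,v$ are adjacent iff $|S(u)\cap S(v)|\ge p$; $\Theta_p(G)$ is the minimum $|U|$ over all such representations. "Replacing each vertex $u$ of a graph $G_0$ by a possibly empty clique $C_u$" means: take disjoint cliques $C_u$ ($u\in V(G_0)$), and for distinct $u,v$ join every vertex of $C_u$ to every vertex of $C_v$ if $uv\in E(G_0)$, with no edges between them otherwise. $K_{1,d}$ is the star with $d$ leaves, $\bar{K}_{d+1}$ the edgeless graph on $d+1$ vertices, $P_n$ the path on $n$ vertices, $C_4$ the 4-cycle, and $\cup$ denotes disjoint union. -}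

module Defs where

open import Data.Nat using (ℕ; zero; suc; _≤_)
open import Data.Fin using (Fin; zero; suc)
open import Data.Fin.Subset using (Subset; _∩_; ∣_∣)
open import Data.Bool using (Bool; true; false; _xor_)
open import Data.Product using (Σ; ∃; _×_; _,_)
open import Data.Sum using (_⊎_)
open import Relation.Binary.PropositionalEquality using (_≡_; _≢_; refl)
open import Relation.Nullary using (¬_)
open import Function.Bundles using (_⇔_)
open import Function.Definitions using (Injective)

record Graph : Set where
  field
    n     : ℕ
    adj   : Fin n → Fin n → Bool
    sym   : ∀ u v → adj u v ≡ adj v u
    irref : ∀ v → adj v v ≡ false
open Graph public

Adj : (G : Graph) → Fin (n G) → Fin (n G) → Set
Adj G u v = adj G u v ≡ true

NoIsolated : Graph → Set
NoIsolated G = ∀ v → ∃ λ u → Adj G v u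

IntRep : ℕ → (G : Graph) → ℕ → Set
IntRep p G m = Σ (Fin (n G) → Subset m) λ S →
  ∀ u v → u ≢ v → (Adj G u v ⇔ (p ≤ ∣ S u ∩ S v ∣))

ThetaLe : ℕ → Graph → ℕ → Set
ThetaLe p G d = Σ ℕ λ m → m ≤ d × IntRep p G m

-- G arises from G₀ by replacing each vertex u of G₀ by a possibly empty clique C_u:
-- there is a map f : V(G) → V(G₀) (C_u = f⁻¹(u)) such that distinct x, y are adjacent
-- iff they lie in the same clique or in cliques of adjacent vertices of G₀.
CliqueBlowup : (G₀ G : Graph) → Set
CliqueBlowup G₀ G = Σ (Fin (n G) → Fin (n G₀)) λ f →
  ∀ x y → x ≢ y → (Adj G x y ⇔ (f x ≡ f y ⊎ Adj G₀ (f x) (f y)))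

InducedSub : (H G : Graph) → Set
InducedSub H G = Σ (Fin (n H) → Fin (n G)) λ φ →
  Injective _≡_ _≡_ φ × (∀ a b → adj H a b ≡ adj G (φ a) (φ b))

isZ : ∀ {k} → Fin k → Bool
isZ zero    = true
isZ (suc _) = false

xor-comm' : ∀ a b → a xor b ≡ b xor a
xor-comm' true  true  = refl
xor-comm' true  false = refl
xor-comm' false true  = refl
xor-comm' false false = refl

xor-self : ∀ a → a xor a ≡ false
xor-self true  = refl
xor-self false = refl

claw : ℕ → Graph
claw d = record { n = suc d ; adj = λ i j → isZ i xor isZ j
                ; sym = λ i j → xor-comm' (isZ i) (isZ j)
                ; irref = λ i → xor-self (isZ i) }

edgeless : ℕ → Graph
edgeless k = record { n = k ; adj = λ _ _ → false ; sym = λ _ _ → refl ; irref = λ _ → refl }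

f0 f1 f2 f3 : Fin 4
f0 = zero
f1 = suc zero
f2 = suc (suc zero)
f3 = suc (suc (suc zero))

-- P4 : 0-1-2-3
adjP4 : Fin 4 → Fin 4 → Bool
adjP4 zero (suc zero) = true
adjP4 (suc zero) zero = true
adjP4 (suc zero) (suc (suc zero)) = true
adjP4 (suc (suc zero)) (suc zero) = true
adjP4 (suc (suc zero)) (suc (suc (suc zero))) = true
adjP4 (suc (suc (suc zero))) (suc (suc zero)) = true
adjP4 _ _ = false

-- K1 ∪ P3 : 0 isolated, 1-2-3
adjK1P3 : Fin 4 → Fin 4 → Bool
adjK1P3 (suc zero) (suc (suc zero)) = true
adjK1P3 (suc (suc zero)) (suc zero) = true
adjK1P3 (suc (suc zero)) (suc (suc (suc zero))) = true
adjK1P3 (suc (suc (suc zero))) (suc (suc zero)) = true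
adjK1P3 _ _ = false

-- C4 : 0-1-2-3-0
adjC4 : Fin 4 → Fin 4 → Bool
adjC4 zero (suc (suc (suc zero))) = true
adjC4 (suc (suc (suc zero))) zero = true
adjC4 i j = adjP4 i j

allFin4 : (P : Fin 4 → Set) → P f0 → P f1 → P f2 → P f3 → ∀ i → P i
allFin4 P a b c d zero = a
allFin4 P a b c d (suc zero) = b
allFin4 P a b c d (suc (suc zero)) = c
allFin4 P a b c d (suc (suc (suc zero))) = d

P4 : Graph
P4 = record { n = 4 ; adj = adjP4 ; sym = s ; irref = allFin4 _ refl refl refl refl }
  where
  s : ∀ i j → adjP4 i j ≡ adjP4 j i
  s = allFin4 _ (allFin4 _ refl refl refl refl) (allFin4 _ refl refl refl refl)
                (allFin4 _ refl refl refl refl) (allFin4 _ refl refl refl refl)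

K1∪P3 : Graph
K1∪P3 = record { n = 4 ; adj = adjK1P3 ; sym = s ; irref = allFin4 _ refl refl refl refl }
  where
  s : ∀ i j → adjK1P3 i j ≡ adjK1P3 j i
  s = allFin4 _ (allFin4 _ refl refl refl refl) (allFin4 _ refl refl refl refl)
                (allFin4 _ refl refl refl refl) (allFin4 _ refl refl refl refl)

C4 : Graph
C4 = record { n = 4 ; adj = adjC4 ; sym = s ; irref = allFin4 _ refl refl refl refl }
  where
  s : ∀ i j → adjC4 i j ≡ adjC4 j i
  s = allFin4 _ (allFin4 _ refl refl refl refl) (allFin4 _ refl refl refl refl)
                (allFin4 _ refl refl refl refl) (allFin4 _ refl refl refl refl)

module Submission where

-- All three conditions are compared with condition (ii), "G is a clique blow-up of
-- the claw K_{1,d}", through the relation SameOrAdj of the claw: two vertices of the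
-- claw are equal or adjacent unless they are two distinct leaves.
--
-- (i) ⇔ (ii).  Give the centre of the claw the whole ground set Fin d and the i-th
--   leaf everything but i.  Then two of these sets meet in at least d-1 points
--   exactly when their vertices are SameOrAdj, so a blow-up yields a representation.
--   Conversely, pad a representation to the ground set Fin d; every vertex has a
--   neighbour, hence a set of size at least d-1, and such a set is one of the claw's
--   sets, which reads off the blow-up map.
-- (ii) ⇒ (iii).  In a claw blow-up the middle vertex of an induced P3 lies over the
--   centre and is adjacent to everything; each of P4, K1∪P3, C4 has an induced P3
--   with a vertex missing its middle.  Independent vertices lie over distinct
--   leaves, so there are at most d of them.
-- (iii) ⇒ (ii).  Excluding P4, K1∪P3 and C4 makes adjacency transitive through
--   non-universal vertices, so the non-universal vertices split into cliques with no
--   edges between them.  One representative per clique gives an independent set,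
--   hence at most d cliques; universal vertices go to the centre, clique number i to
--   leaf i.

open import Defs hiding (sym)
open import Data.Nat using (ℕ; zero; suc; _≤_; z≤n; _∸_; s≤s; _≤′_; ≤′-refl; ≤′-step; _≤?_)
open import Data.Nat.Properties
  using (≤-refl; ≤-trans; ≤-antisym; ≤-reflexive; ≤⇒≤′; 1+n≰n; n≤1+n; ≰⇒>; n<1+n)
open import Data.Fin using (Fin; zero; suc; _<_; inject≤; punchOut)
open import Data.Fin.Properties
  using (suc-injective; inject≤-injective; punchOut-injective; pigeonhole; any?; <-cmp; <⇒≢)
  renaming (_≟_ to _≟ᶠ_)
open import Data.Fin.Subset using (Subset; ⊤; _∩_; ∣_∣; outside; inside)
open import Data.Fin.Subset.Properties
  using (∣⊤∣≡n; ∣p∣≤n; ∣p∣≡n⇒p≡⊤; ∣p∩q∣≤∣p∣; ∩-identityˡ; ∩-identityʳ; ∩-idem)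
open import Data.Vec using ([]; _∷_)
open import Data.Bool using (true; false)
open import Data.Bool.Properties using (¬-not; not-¬) renaming (_≟_ to _≟ᵇ_)
open import Data.List using (List; length; lookup; filter; allFin; deduplicate)
open import Data.List.Relation.Unary.All using (All) renaming (lookup to All-lookup)
open import Data.List.Relation.Unary.All.Properties
  using (all-filter) renaming (deduplicate⁺ to All-deduplicate⁺)
import Data.List.Relation.Unary.Any as Any
open import Data.List.Relation.Unary.Any.Properties using (lookup-index)
open import Data.List.Membership.Propositional.Properties using (∈-filter⁺; ∈-allFin; ∈-lookup)
import Data.List.Membership.Setoid as SetoidMembership
open import Data.List.Membership.Setoid.Properties using (∈-deduplicate⁺)
open import Data.List.Relation.Unary.Unique.Setoid using (Unique)
open import Data.List.Relation.Unary.AllPairs using (_∷_)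
open import Data.List.Relation.Unary.Unique.DecSetoid.Properties using (deduplicate-!)
open import Data.Product using (∃; _×_; _,_; proj₁; proj₂)
open import Data.Sum using (_⊎_; inj₁; inj₂)
open import Data.Empty using (⊥; ⊥-elim)
open import Relation.Binary.PropositionalEquality
  using (_≡_; _≢_; refl; sym; trans; cong; subst; subst₂; ≢-sym)
open import Level using (0ℓ)
open import Relation.Binary.Bundles using (DecSetoid)
open import Relation.Binary.Definitions using (tri<; tri≈; tri>)
open import Relation.Nullary using (¬_; Dec; yes; no)
open import Relation.Nullary.Decidable using (¬?; _×-dec_; _⊎-dec_)
open import Function using (_∘_)
open import Function.Bundles using (_⇔_; mk⇔; Equivalence)
open import Function.Properties.Equivalence using () renaming (trans to ⇔-trans; sym to ⇔-sym)
open import Function.Definitions using (Injective)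

open Equivalence using (to; from)

-- u and v are equal or adjacent: the relation a clique blow-up has to reflect.
SameOrAdj : (G : Graph) → Fin (n G) → Fin (n G) → Set
SameOrAdj G u v = u ≡ v ⊎ Adj G u v

Adj-sym : ∀ G {u v} → Adj G u v → Adj G v u
Adj-sym G {u} {v} uv = trans (Graph.sym G v u) uv

Adj-≢ : ∀ G {u v} → Adj G u v → u ≢ v
Adj-≢ G {u} uv refl = not-¬ uv (irref G u)

SameOrAdj-sym : ∀ G {u v} → SameOrAdj G u v → SameOrAdj G v u
SameOrAdj-sym G (inj₁ u≡v) = inj₁ (sym u≡v)
SameOrAdj-sym G (inj₂ uv)  = inj₂ (Adj-sym G uv)

Faithful : (H G : Graph) → (Fin (n H) → Fin (n G)) → Fin (n H) → Fin (n H) → Set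
Faithful H G φ a b = φ a ≢ φ b × adj G (φ a) (φ b) ≡ adj H a b

-- By symmetry and irreflexivity it suffices to check an embedding on pairs a < b.
induced-by-pairs : (H G : Graph) (φ : Fin (n H) → Fin (n G)) →
  (∀ {a b} → a < b → Faithful H G φ a b) → InducedSub H G
induced-by-pairs H G φ faithful = φ , injective , adjacency
  where
  injective : Injective _≡_ _≡_ φ
  injective {a} {b} φa≡φb with <-cmp a b
  ... | tri< a<b _ _ = ⊥-elim (proj₁ (faithful a<b) φa≡φb)
  ... | tri≈ _ a≡b _ = a≡b
  ... | tri> _ _ b<a = ⊥-elim (proj₁ (faithful b<a) (sym φa≡φb))
  adjacency : ∀ a b → adj H a b ≡ adj G (φ a) (φ b)
  adjacency a b with <-cmp a b
  ... | tri< a<b _ _ = sym (proj₂ (faithful a<b))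
  ... | tri≈ _ refl _ = trans (irref H a) (sym (irref G (φ a)))
  ... | tri> _ _ b<a =
    trans (Graph.sym H a b) (trans (sym (proj₂ (faithful b<a))) (Graph.sym G (φ b) (φ a)))

four-pairs : (P : Fin 4 → Fin 4 → Set) →
  P f0 f1 → P f0 f2 → P f0 f3 → P f1 f2 → P f1 f3 → P f2 f3 → ∀ {a b} → a < b → P a b
four-pairs P p01 p02 p03 p12 p13 p23 {zero} {suc zero} _ = p01
four-pairs P p01 p02 p03 p12 p13 p23 {zero} {suc (suc zero)} _ = p02
four-pairs P p01 p02 p03 p12 p13 p23 {zero} {suc (suc (suc zero))} _ = p03
four-pairs P p01 p02 p03 p12 p13 p23 {suc zero} {suc (suc zero)} _ = p12
four-pairs P p01 p02 p03 p12 p13 p23 {suc zero} {suc (suc (suc zero))} _ = p13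
four-pairs P p01 p02 p03 p12 p13 p23 {suc (suc zero)} {suc (suc (suc zero))} _ = p23
four-pairs P _ _ _ _ _ _ {zero} {zero} ()
four-pairs P _ _ _ _ _ _ {suc _} {zero} ()
four-pairs P _ _ _ _ _ _ {suc zero} {suc zero} (s≤s ())
four-pairs P _ _ _ _ _ _ {suc (suc _)} {suc zero} (s≤s ())
four-pairs P _ _ _ _ _ _ {suc (suc zero)} {suc (suc zero)} (s≤s (s≤s ()))
four-pairs P _ _ _ _ _ _ {suc (suc (suc zero))} {suc (suc zero)} (s≤s (s≤s ()))
four-pairs P _ _ _ _ _ _ {suc (suc (suc zero))} {suc (suc (suc zero))} (s≤s (s≤s (s≤s ())))

quad : {A : Set} → A → A → A → A → Fin 4 → A
quad w₀ w₁ w₂ w₃ zero                   = w₀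
quad w₀ w₁ w₂ w₃ (suc zero)             = w₁
quad w₀ w₁ w₂ w₃ (suc (suc zero))       = w₂
quad w₀ w₁ w₂ w₃ (suc (suc (suc zero))) = w₃

-- The claw K_{1,d}: vertex zero is the centre, suc i is the i-th leaf

module _ {d : ℕ} where

  ClawRel : Fin (suc d) → Fin (suc d) → Set
  ClawRel = SameOrAdj (claw d)

  centre-relatedˡ : ∀ i → ClawRel zero i
  centre-relatedˡ zero    = inj₁ refl
  centre-relatedˡ (suc i) = inj₂ refl

  centre-relatedʳ : ∀ i → ClawRel i zero
  centre-relatedʳ i = SameOrAdj-sym (claw d) (centre-relatedˡ i)

  leaves-related : {i j : Fin d} → ClawRel (suc i) (suc j) ⇔ i ≡ j
  leaves-related = mk⇔ (λ { (inj₁ e) → suc-injective e ; (inj₂ ()) }) (λ i≡j → inj₁ (cong suc i≡j))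

  leaf-neighbour : ∀ {p} {q : Fin d} → ClawRel p (suc q) → p ≡ zero ⊎ p ≡ suc q
  leaf-neighbour {zero}  _          = inj₁ refl
  leaf-neighbour {suc p} (inj₁ e)   = inj₂ e
  leaf-neighbour {suc p} (inj₂ ())

  P3-middle-centre : ∀ {p q r} → ClawRel p q → ClawRel q r → ¬ ClawRel p r → q ≡ zero
  P3-middle-centre {q = zero} _ _ _ = refl
  P3-middle-centre {p} {suc q} {r} pq qr ¬pr =
    ⊥-elim (¬pr (related (leaf-neighbour pq) (leaf-neighbour (SameOrAdj-sym (claw d) qr))))
    where
    related : p ≡ zero ⊎ p ≡ suc q → r ≡ zero ⊎ r ≡ suc q → ClawRel p r
    related (inj₁ refl) _           = centre-relatedˡ r
    related (inj₂ refl) (inj₁ refl) = centre-relatedʳ p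
    related (inj₂ refl) (inj₂ refl) = inj₁ refl

-- The intersection representation of the claw

allBut : ∀ {k} → Fin k → Subset k
allBut zero    = outside ∷ ⊤
allBut (suc i) = inside ∷ allBut i

∣allBut∣ : ∀ {k} (i : Fin (suc k)) → ∣ allBut i ∣ ≡ k
∣allBut∣ {k}     zero    = ∣⊤∣≡n k
∣allBut∣ {suc k} (suc i) = cong suc (∣allBut∣ i)

∣allBut∩allBut∣ : ∀ {k} (i j : Fin (suc k)) → i ≢ j → suc ∣ allBut i ∩ allBut j ∣ ≡ k
∣allBut∩allBut∣ zero zero i≢j = ⊥-elim (i≢j refl)
∣allBut∩allBut∣ {suc k} zero (suc j) _ =
  cong suc (trans (cong ∣_∣ (∩-identityˡ (allBut j))) (∣allBut∣ j))
∣allBut∩allBut∣ {suc k} (suc i) zero _ =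
  cong suc (trans (cong ∣_∣ (∩-identityʳ (allBut i))) (∣allBut∣ i))
∣allBut∩allBut∣ {suc k} (suc i) (suc j) i≢j = cong suc (∣allBut∩allBut∣ i j (i≢j ∘ cong suc))

allBut-threshold : ∀ {d'} (i j : Fin (suc d')) → d' ≤ ∣ allBut i ∩ allBut j ∣ ⇔ i ≡ j
allBut-threshold i j with i ≟ᶠ j
... | yes refl = mk⇔ (λ _ → refl)
  (λ _ → ≤-reflexive (sym (trans (cong ∣_∣ (∩-idem (allBut i))) (∣allBut∣ i))))
... | no i≢j = mk⇔ (λ large → ⊥-elim (1+n≰n (≤-trans (≤-reflexive (∣allBut∩allBut∣ i j i≢j)) large)))
  (λ i≡j → ⊥-elim (i≢j i≡j))

clawSet : ∀ {d} → Fin (suc d) → Subset d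
clawSet zero    = ⊤
clawSet (suc i) = allBut i

clawSet-large : ∀ {d'} (i : Fin (suc (suc d'))) → d' ≤ ∣ clawSet i ∣
clawSet-large {d'} zero    = ≤-trans (n≤1+n d') (≤-reflexive (sym (∣⊤∣≡n (suc d'))))
clawSet-large      (suc i) = ≤-reflexive (sym (∣allBut∣ i))

clawSet-threshold : ∀ {d'} (i j : Fin (suc (suc d'))) →
  d' ≤ ∣ clawSet i ∩ clawSet j ∣ ⇔ ClawRel i j
clawSet-threshold zero j = mk⇔ (λ _ → centre-relatedˡ j)
  (λ _ → ≤-trans (clawSet-large j) (≤-reflexive (cong ∣_∣ (sym (∩-identityˡ (clawSet j))))))
clawSet-threshold (suc i) zero = mk⇔ (λ _ → centre-relatedʳ (suc i))
  (λ _ → ≤-trans (clawSet-large (suc i)) (≤-reflexive (cong ∣_∣ (sym (∩-identityʳ (allBut i))))))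
clawSet-threshold (suc i) (suc j) = ⇔-trans (allBut-threshold i j) (⇔-sym leaves-related)

large⇒clawSet : ∀ {k} (X : Subset (suc k)) → k ≤ ∣ X ∣ → ∃ λ i → X ≡ clawSet i
large⇒clawSet {zero}  (inside  ∷ []) _ = zero , refl
large⇒clawSet {zero}  (outside ∷ []) _ = suc zero , refl
large⇒clawSet {suc k} (inside ∷ X) (s≤s k≤∣X∣) with large⇒clawSet X k≤∣X∣
... | zero  , X≡⊤       = zero , cong (inside ∷_) X≡⊤
... | suc i , X≡allBut = suc (suc i) , cong (inside ∷_) X≡allBut
large⇒clawSet {suc k} (outside ∷ X) k<∣X∣ =
  suc zero , cong (outside ∷_) (∣p∣≡n⇒p≡⊤ (≤-antisym (∣p∣≤n X) k<∣X∣))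

-- (i) ⇔ (ii): intersection representations and claw blow-ups

IntRep-suc : ∀ {p G m} → IntRep p G m → IntRep p G (suc m)
IntRep-suc (S , represents) = (λ x → outside ∷ S x) , represents

IntRep-mono : ∀ {p G m m'} → m ≤ m' → IntRep p G m → IntRep p G m'
IntRep-mono {p} {G} m≤m' = grow (≤⇒≤′ m≤m')
  where
  grow : ∀ {m m'} → m ≤′ m' → IntRep p G m → IntRep p G m'
  grow ≤′-refl        R = R
  grow (≤′-step m≤m') R = IntRep-suc {p} {G} (grow m≤m' R)

neighbour⇒large : ∀ {p G m} ((S , _) : IntRep p G m) {x u} → Adj G x u → p ≤ ∣ S x ∣
neighbour⇒large {G = G} (S , represents) {x} {u} xu =
  ≤-trans (to (represents x u (Adj-≢ G xu)) xu) (∣p∩q∣≤∣p∣ (S x) (S u))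

blowup⇒theta : ∀ {d'} G → CliqueBlowup (claw (suc d')) G → ThetaLe d' G (suc d')
blowup⇒theta G (f , blowup) = _ , ≤-refl , clawSet ∘ f ,
  λ x y x≢y → ⇔-trans (blowup x y x≢y) (⇔-sym (clawSet-threshold (f x) (f y)))

-- on the ground set Fin d every set is a claw set, which defines the blow-up map
rep⇒blowup : ∀ {d'} G → NoIsolated G → IntRep d' G (suc d') → CliqueBlowup (claw (suc d')) G
rep⇒blowup {d'} G noIsolated (S , represents) = f ,
  λ x y x≢y → ⇔-trans (subst₂ (λ X Y → Adj G x y ⇔ (d' ≤ ∣ X ∩ Y ∣)) (S≡ x) (S≡ y) (represents x y x≢y))
                      (clawSet-threshold (f x) (f y))
  where
  classified : ∀ x → ∃ λ i → S x ≡ clawSet i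
  classified x = large⇒clawSet (S x) (neighbour⇒large {G = G} (S , represents) (proj₂ (noIsolated x)))
  f : Fin (n G) → Fin (suc (suc d'))
  f = proj₁ ∘ classified
  S≡ : ∀ x → S x ≡ clawSet (f x)
  S≡ = proj₂ ∘ classified

theta⇒blowup : ∀ {d'} G → NoIsolated G → ThetaLe d' G (suc d') → CliqueBlowup (claw (suc d')) G
theta⇒blowup G noIsolated (m , m≤d , R) = rep⇒blowup G noIsolated (IntRep-mono {G = G} m≤d R)

-- (ii) ⇒ (iii): forbidden induced subgraphs of claw blow-ups

module ClawBlowup {d : ℕ} (G : Graph) (f : Fin (n G) → Fin (suc d))
  (blowup : ∀ x y → x ≢ y → Adj G x y ⇔ ClawRel (f x) (f y)) where

  unrelated : ∀ {x y} → x ≢ y → adj G x y ≡ false → ¬ ClawRel (f x) (f y)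
  unrelated {x} {y} x≢y xy related = not-¬ (from (blowup x y x≢y) related) xy

  P3-middle-universal : ∀ {a b c} → Adj G a b → Adj G b c → a ≢ c → adj G a c ≡ false →
    ∀ x → x ≢ b → Adj G x b
  P3-middle-universal {a} {b} {c} ab bc a≢c ac x x≢b = from (blowup x b x≢b) x~b
    where
    fb≡centre : f b ≡ zero
    fb≡centre = P3-middle-centre (to (blowup a b (Adj-≢ G ab)) ab) (to (blowup b c (Adj-≢ G bc)) bc)
                                 (unrelated a≢c ac)
    x~b : ClawRel (f x) (f b)
    x~b = subst (ClawRel (f x)) (sym fb≡centre) (centre-relatedʳ (f x))

  no-P3-with-outsider : (H : Graph) → InducedSub H G → (a b c x : Fin (n H)) →
    Adj H a b → Adj H b c → a ≢ c → adj H a c ≡ false → x ≢ b → adj H x b ≡ false → ⊥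
  no-P3-with-outsider H (φ , φ-inj , φ-adj) a b c x ab bc a≢c ac x≢b xb =
    not-¬ (P3-middle-universal (in-G a b ab) (in-G b c bc) (a≢c ∘ φ-inj) (in-G a c ac)
                               (φ x) (x≢b ∘ φ-inj))
          (in-G x b xb)
    where
    in-G : ∀ {β} u v → adj H u v ≡ β → adj G (φ u) (φ v) ≡ β
    in-G u v uv = trans (sym (φ-adj u v)) uv

  no-P4 : ¬ InducedSub P4 G
  no-P4 emb = no-P3-with-outsider P4 emb f0 f1 f2 f3 refl refl (λ ()) refl (λ ()) refl

  no-K1∪P3 : ¬ InducedSub K1∪P3 G
  no-K1∪P3 emb = no-P3-with-outsider K1∪P3 emb f1 f2 f3 f0 refl refl (λ ()) refl (λ ()) refl

  no-C4 : ¬ InducedSub C4 G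
  no-C4 emb = no-P3-with-outsider C4 emb f0 f1 f2 f3 refl refl (λ ()) refl (λ ()) refl

  -- independent vertices lie over distinct leaves, so there are at most d of them
  no-independent : 1 ≤ d → ¬ InducedSub (edgeless (suc d)) G
  no-independent (s≤s {n = d'} z≤n) (φ , φ-inj , φ-adj) = collision (pigeonhole (n<1+n (suc d')) leaf)
    where
    unrelated-images : ∀ {a b} → a ≢ b → ¬ ClawRel (f (φ a)) (f (φ b))
    unrelated-images {a} {b} a≢b = unrelated (a≢b ∘ φ-inj) (sym (φ-adj a b))
    -- each vertex has another one, which it misses; so it does not lie over the centre
    other : (a : Fin (suc (suc d'))) → ∃ λ b → b ≢ a
    other zero    = suc zero , λ ()
    other (suc _) = zero , λ ()
    off-centre : ∀ a → zero ≢ f (φ a)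
    off-centre a centre with other a
    ... | b , b≢a = unrelated-images b≢a (subst (ClawRel (f (φ b))) centre (centre-relatedʳ (f (φ b))))
    leaf : Fin (suc (suc d')) → Fin (suc d')
    leaf a = punchOut (off-centre a)
    collision : (∃ λ i → ∃ λ j → i < j × leaf i ≡ leaf j) → ⊥
    collision (i , j , i<j , same-leaf) =
      unrelated-images (<⇒≢ i<j) (inj₁ (punchOut-injective (off-centre i) (off-centre j) same-leaf))

blowup⇒forbidden : ∀ {d'} G → CliqueBlowup (claw (suc d')) G →
  ¬ InducedSub (edgeless (suc (suc d'))) G × ¬ InducedSub P4 G ×
  ¬ InducedSub K1∪P3 G × ¬ InducedSub C4 G
blowup⇒forbidden G (f , blowup) = no-independent (s≤s z≤n) , no-P4 , no-K1∪P3 , no-C4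
  where open ClawBlowup G f blowup

-- Classes of a decidable equivalence met by a list

module Classes {a ℓ} (S : DecSetoid a ℓ) (xs : List (DecSetoid.Carrier S)) where

  open DecSetoid S using (Carrier; _≈_; _≟_; setoid)
    renaming (reflexive to ≈-reflexive; sym to ≈-sym; trans to ≈-trans)
  open SetoidMembership setoid using (_∈_)

  reps : List Carrier
  reps = deduplicate _≟_ xs

  reps-distinct : Unique setoid reps
  reps-distinct = deduplicate-! S xs

  lookup-injective : ∀ {ys} → Unique setoid ys → ∀ i j → lookup ys i ≈ lookup ys j → i ≡ j
  lookup-injective (_    ∷ _)   zero    zero    _ = refl
  lookup-injective (y≉ys ∷ _)   zero    (suc j) e = ⊥-elim (All-lookup y≉ys (∈-lookup j) e)
  lookup-injective (y≉ys ∷ _)   (suc i) zero    e = ⊥-elim (All-lookup y≉ys (∈-lookup i) (≈-sym e))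
  lookup-injective (_    ∷ ys!) (suc i) (suc j) e = cong suc (lookup-injective ys! i j e)

  reps-cover : ∀ {x} → x ∈ xs → x ∈ reps
  reps-cover = ∈-deduplicate⁺ setoid _≟_ (λ z≈y x≈y → ≈-trans x≈y (≈-sym z≈y))

  classOf : ∀ {x} → x ∈ xs → Fin (length reps)
  classOf = Any.index ∘ reps-cover

  classOf-≡⇔≈ : ∀ {x y} (x∈ : x ∈ xs) (y∈ : y ∈ xs) → classOf x∈ ≡ classOf y∈ ⇔ x ≈ y
  classOf-≡⇔≈ x∈ y∈ = mk⇔
    (λ same → ≈-trans (rep-of x∈) (≈-trans (≈-reflexive (cong (lookup reps) same)) (≈-sym (rep-of y∈))))
    (λ x≈y → lookup-injective reps-distinct _ _ (≈-trans (≈-sym (rep-of x∈)) (≈-trans x≈y (rep-of y∈))))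
    where
    rep-of : ∀ {z} (z∈ : z ∈ xs) → z ≈ lookup reps (classOf z∈)
    rep-of z∈ = lookup-index (reps-cover z∈)

-- (iii) ⇒ (ii): graphs without induced P4, K1∪P3 and C4

module ForbiddenFree (G : Graph) (no-P4 : ¬ InducedSub P4 G) (no-K1∪P3 : ¬ InducedSub K1∪P3 G)
  (no-C4 : ¬ InducedSub C4 G) where

  V : Set
  V = Fin (n G)


  NonUniversal : V → Set
  NonUniversal x = ∃ λ z → z ≢ x × adj G x z ≡ false

  nonUniversal? : ∀ x → Dec (NonUniversal x)
  nonUniversal? x = any? (λ z → ¬? (z ≟ᶠ x) ×-dec (adj G x z ≟ᵇ false))

  universal : ∀ {x y} → ¬ NonUniversal x → x ≢ y → Adj G x y
  universal ¬nu x≢y = ¬-not (λ xy → ¬nu (_ , ≢-sym x≢y , xy))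

  misses⇒≢ : ∀ {x y w} → adj G x w ≡ false → Adj G y w → x ≢ y
  misses⇒≢ xw yw refl = not-¬ yw xw

  -- an induced P3 a - b - c with a vertex z missing b and c: z, a, b, c induce K1∪P3 or P4
  no-P3-missed-at-end : ∀ {z a b c} → z ≢ b → adj G z b ≡ false → adj G z c ≡ false →
    Adj G a b → Adj G b c → a ≢ c → adj G a c ≡ false → ⊥
  no-P3-missed-at-end {z} {a} {b} {c} z≢b zb zc ab bc a≢c ac = by-za (adj G z a) refl
    where
    w : Fin 4 → V
    w = quad z a b c
    z≢a : z ≢ a
    z≢a = misses⇒≢ zb ab
    z≢c : z ≢ c
    z≢c = misses⇒≢ zb (Adj-sym G bc)
    by-za : ∀ α → adj G z a ≡ α → ⊥
    by-za false za = no-K1∪P3 (induced-by-pairs K1∪P3 G w (four-pairs (Faithful K1∪P3 G w)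
      (z≢a , za) (z≢b , zb) (z≢c , zc) (Adj-≢ G ab , ab) (a≢c , ac) (Adj-≢ G bc , bc)))
    by-za true za = no-P4 (induced-by-pairs P4 G w (four-pairs (Faithful P4 G w)
      (z≢a , za) (z≢b , zb) (z≢c , zc) (Adj-≢ G ab , ab) (a≢c , ac) (Adj-≢ G bc , bc)))

  -- the key consequence of the excluded subgraphs: a path a - b - c through a
  -- non-universal b closes to a triangle (a vertex z missing b, together with a, b, c,
  -- would induce K1∪P3, P4 or C4)
  nonUniversal-closes : ∀ {a b c} → NonUniversal b → Adj G a b → Adj G b c → a ≢ c → Adj G a c
  nonUniversal-closes {a} {b} {c} (z , z≢b , bz) ab bc a≢c =
    ¬-not (λ ac → by-z (adj G z c) (adj G z a) refl refl ac)
    where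
    w : Fin 4 → V
    w = quad z a b c
    zb : adj G z b ≡ false
    zb = trans (Graph.sym G z b) bz
    -- z misses c: K1∪P3 or P4; z misses a only: P4 read backwards; z sees a and c: C4
    by-z : ∀ γ α → adj G z c ≡ γ → adj G z a ≡ α → adj G a c ≡ false → ⊥
    by-z false _ zc _ ac = no-P3-missed-at-end z≢b zb zc ab bc a≢c ac
    by-z true false _ za ac = no-P3-missed-at-end z≢b zb za (Adj-sym G bc) (Adj-sym G ab) (≢-sym a≢c)
      (trans (Graph.sym G c a) ac)
    by-z true true zc za ac = no-C4 (induced-by-pairs C4 G w (four-pairs (Faithful C4 G w)
      (misses⇒≢ zb ab , za) (z≢b , zb) (misses⇒≢ zb (Adj-sym G bc) , zc)
      (Adj-≢ G ab , ab) (a≢c , ac) (Adj-≢ G bc , bc)))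

  _∼_ : V → V → Set
  x ∼ y = x ≡ y ⊎ (NonUniversal x × NonUniversal y × Adj G x y)

  _∼?_ : ∀ x y → Dec (x ∼ y)
  x ∼? y = x ≟ᶠ y ⊎-dec (nonUniversal? x ×-dec nonUniversal? y ×-dec (adj G x y ≟ᵇ true))

  ∼-sym : ∀ {x y} → x ∼ y → y ∼ x
  ∼-sym (inj₁ x≡y)             = inj₁ (sym x≡y)
  ∼-sym (inj₂ (nx , ny , xy)) = inj₂ (ny , nx , Adj-sym G xy)

  ∼-trans : ∀ {x y z} → x ∼ y → y ∼ z → x ∼ z
  ∼-trans (inj₁ refl) y∼z = y∼z
  ∼-trans x∼y (inj₁ refl) = x∼y
  ∼-trans {x} {y} {z} (inj₂ (nx , ny , xy)) (inj₂ (_ , nz , yz)) with x ≟ᶠ z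
  ... | yes x≡z = inj₁ x≡z
  ... | no  x≢z = inj₂ (nx , nz , nonUniversal-closes ny xy yz x≢z)

  cliques : DecSetoid 0ℓ 0ℓ
  cliques = record
    { Carrier          = V
    ; _≈_              = _∼_
    ; isDecEquivalence = record
      { isEquivalence = record { refl = inj₁ refl ; sym = ∼-sym ; trans = ∼-trans }
      ; _≟_           = _∼?_
      }
    }

  nonUniversals : List V
  nonUniversals = filter nonUniversal? (allFin (n G))

  open Classes cliques nonUniversals
  open SetoidMembership (DecSetoid.setoid cliques) using () renaming (_∈_ to _∈ₛ_)

  member : ∀ {x} → NonUniversal x → x ∈ₛ nonUniversals
  member nu = Any.map (λ { refl → inj₁ refl }) (∈-filter⁺ nonUniversal? (∈-allFin _) nu)

  rep-nonUniversal : ∀ i → NonUniversal (lookup reps i)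
  rep-nonUniversal i =
    All-lookup (All-deduplicate⁺ _∼?_ (all-filter nonUniversal? (allFin (n G)))) (∈-lookup i)

  reps-independent : ∀ {i j} → i ≢ j → adj G (lookup reps i) (lookup reps j) ≡ false
  reps-independent {i} {j} i≢j = ¬-not λ adjacent →
    i≢j (lookup-injective reps-distinct i j (inj₂ (rep-nonUniversal i , rep-nonUniversal j , adjacent)))

  reps-bounded : ∀ d' → ¬ InducedSub (edgeless (suc (suc d'))) G → length reps ≤ suc d'
  reps-bounded d' no-independent with length reps ≤? suc d'
  ... | yes bounded   = bounded
  ... | no  unbounded = ⊥-elim (no-independent (induced-by-pairs (edgeless _) G φ faithful))
    where
    φ : Fin (suc (suc d')) → V
    φ i = lookup reps (inject≤ i (≰⇒> unbounded))
    faithful : ∀ {a b} → a < b → Faithful (edgeless _) G φ a b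
    faithful {a} {b} a<b = (λ φa≡φb → <⇒≢ a<b (inject≤-injective _ _ a b
                              (lookup-injective reps-distinct _ _ (inj₁ φa≡φb))))
                         , reps-independent (<⇒≢ a<b ∘ inject≤-injective _ _ a b)

  module Blowup (d' : ℕ) (no-independent : ¬ InducedSub (edgeless (suc (suc d'))) G) where

    bounded : length reps ≤ suc d'
    bounded = reps-bounded d' no-independent

    place : (x : V) → Dec (NonUniversal x) → Fin (suc (suc d'))
    place x (no _)   = zero
    place x (yes nu) = suc (inject≤ (classOf (member nu)) bounded)

    adj⇔∼ : ∀ {x y} → x ≢ y → NonUniversal x → NonUniversal y → Adj G x y ⇔ x ∼ y
    adj⇔∼ x≢y nx ny = mk⇔ (λ xy → inj₂ (nx , ny , xy))
      (λ { (inj₁ x≡y) → ⊥-elim (x≢y x≡y) ; (inj₂ (_ , _ , xy)) → xy })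

    inject≤-≡⇔ : ∀ {i j : Fin (length reps)} → inject≤ i bounded ≡ inject≤ j bounded ⇔ i ≡ j
    inject≤-≡⇔ {i} {j} = mk⇔ (inject≤-injective _ _ i j) (cong (λ k → inject≤ k bounded))

    place-correct : ∀ x y → x ≢ y → (dx : Dec (NonUniversal x)) (dy : Dec (NonUniversal y)) →
      Adj G x y ⇔ ClawRel (place x dx) (place y dy)
    place-correct x y x≢y (no ¬nx) (no _) = mk⇔ (λ _ → inj₁ refl) (λ _ → universal ¬nx x≢y)
    place-correct x y x≢y (no ¬nx) (yes _) = mk⇔ (λ _ → centre-relatedˡ _) (λ _ → universal ¬nx x≢y)
    place-correct x y x≢y (yes _) (no ¬ny) =
      mk⇔ (λ _ → centre-relatedʳ _) (λ _ → Adj-sym G (universal ¬ny (≢-sym x≢y)))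
    place-correct x y x≢y (yes nx) (yes ny) =
      ⇔-trans (adj⇔∼ x≢y nx ny)
        (⇔-trans (⇔-sym (classOf-≡⇔≈ (member nx) (member ny)))
          (⇔-trans (⇔-sym inject≤-≡⇔) (⇔-sym leaves-related)))

    blowup : CliqueBlowup (claw (suc d')) G
    blowup = (λ x → place x (nonUniversal? x)) , λ x y x≢y → place-correct x y x≢y _ _

forbidden⇒blowup : ∀ {d'} G → ¬ InducedSub (edgeless (suc (suc d'))) G → ¬ InducedSub P4 G →
  ¬ InducedSub K1∪P3 G → ¬ InducedSub C4 G → CliqueBlowup (claw (suc d')) G
forbidden⇒blowup {d'} G no-independent no-P4 no-K1∪P3 no-C4 =
  ForbiddenFree.Blowup.blowup G no-P4 no-K1∪P3 no-C4 d' no-independent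

-- The theorem; the hypothesis 2 ≤ d is only used to exclude d = 0

theorem3 : (d : ℕ) → 2 ≤ d → (G : Graph) → NoIsolated G →
    (ThetaLe (d ∸ 1) G d ⇔ CliqueBlowup (claw d) G) ×
    (CliqueBlowup (claw d) G ⇔
      (¬ InducedSub (edgeless (suc d)) G × ¬ InducedSub P4 G ×
       ¬ InducedSub K1∪P3 G × ¬ InducedSub C4 G))
theorem3 zero    () G noIsolated
theorem3 (suc d') _  G noIsolated =
  mk⇔ (theta⇒blowup G noIsolated) (blowup⇒theta G) ,
  mk⇔ (blowup⇒forbidden G)
      (λ (no-independent , no-P4 , no-K1∪P3 , no-C4) →
         forbidden⇒blowup G no-independent no-P4 no-K1∪P3 no-C4)
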